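{- Let $G$ be a tight graph and let $T$ be the set of dense vertices of $G$. Then in every tight b-colouring $c$ of $G$ (if one exists): (i) $T$ is exactly the set of b-chromatic vertices under $c$; (ii) each colour class of $c$ contains exactly one vertex of $T$, and this vertex has a unique neighbour in each of the other colour classes of $c$; (iii) every vertex of $T_1=\{v\in T: v \text{ is adjacent to all vertices of } T\setminus\{v\}\}$ belongs to a colour class of $c$ that contains no vertex of $\delta T$.
   Context: Graphs are finite and simple. A colouring of $G=(V,E)$ is a map $c:V\to\mathbb{Z}^+$ with $c(u)\ne c(v)$ for every edge $uv$. A vertex is b-chromatic if it is adjacent to a vertex of every colour other than its own; a b-colouring is a colouring in which every colour class has a b-chromatic vertex. $m(G)$ is the largest $k$ such that $G$ has at least $k$ vertices of degree at least $k-1$; a vertex of degree at least $m(G)-1$ is dense; $G$ is tight if it has exactly $m(G)$ dense vertices, each of degree exactly $m(G)-1$. A tight b-colouring is a b-colouring with exactly $m(G)$ colours. For $S\subseteq V$, the outer boundary is $\delta S=\left(\bigcup_{u\in S}N(u)\right)\setminus S$. -}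

module Defs where

open import Data.Nat using (ℕ; zero; suc; _∸_; _≤_; _≤ᵇ_)
import Data.Nat.Properties as ℕP
open import Data.Bool using (Bool; true; false; if_then_else_)
open import Data.Fin using (Fin)
open import Data.List using (List; []; _∷_; length; map; deduplicate)
open import Data.List.Base using (allFin)
open import Data.Product using (Σ; ∃; _×_; _,_)
open import Relation.Binary.PropositionalEquality using (_≡_; _≢_)

record Graph (n : ℕ) : Set where
  field
    adj   : Fin n → Fin n → Bool
    sym   : ∀ u v → adj u v ≡ adj v u
    irref : ∀ v → adj v v ≡ false

countᵇ : {A : Set} → (A → Bool) → List A → ℕ
countᵇ p [] = 0
countᵇ p (x ∷ xs) = if p x then suc (countᵇ p xs) else countᵇ p xs

module _ {n : ℕ} (G : Graph n) where
  open Graph G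

  Adj : Fin n → Fin n → Set
  Adj u v = adj u v ≡ true

  degree : Fin n → ℕ
  degree v = countᵇ (adj v) (allFin n)

  numDeg≥ : ℕ → ℕ
  numDeg≥ k = countᵇ (λ v → (k ∸ 1) ≤ᵇ degree v) (allFin n)

  mAux : ℕ → ℕ
  mAux zero = zero
  mAux (suc k) = if suc k ≤ᵇ numDeg≥ (suc k) then suc k else mAux k

  -- m(G); any k with at least k vertices satisfies k ≤ n, so searching
  -- downward from n yields the largest such k.
  m : ℕ
  m = mAux n

  Dense : Fin n → Set
  Dense v = m ∸ 1 ≤ degree v

  numDense : ℕ
  numDense = countᵇ (λ v → (m ∸ 1) ≤ᵇ degree v) (allFin n)

  Tight : Set
  Tight = numDense ≡ m × (∀ v → Dense v → degree v ≡ m ∸ 1)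

  Colouring : (Fin n → ℕ) → Set
  Colouring c = (∀ v → 1 ≤ c v) × (∀ u v → Adj u v → c u ≢ c v)

  numColours : (Fin n → ℕ) → ℕ
  numColours c = length (deduplicate ℕP._≟_ (map c (allFin n)))

  BChromatic : (Fin n → ℕ) → Fin n → Set
  BChromatic c v = ∀ w → c w ≢ c v → ∃ λ u → Adj v u × c u ≡ c w

  BColouring : (Fin n → ℕ) → Set
  BColouring c = Colouring c × (∀ v → ∃ λ u → c u ≡ c v × BChromatic c u)

  TightBColouring : (Fin n → ℕ) → Set
  TightBColouring c = BColouring c × numColours c ≡ m

  InBoundaryT : Fin n → Set
  InBoundaryT w = (Dense w → Data.Empty.⊥) × ∃ λ u → Dense u × Adj u w
    where import Data.Empty

-- Let C be the duplicate-free list of colours of c and D the list of dense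
-- vertices; both have length m. A b-chromatic vertex v sees every colour of C
-- on v or a neighbour, so m ≤ 1 + deg v and v is dense. Every colour class has
-- a b-chromatic, hence dense, vertex, so c maps D onto C; since |D| = |C|, c is
-- injective on D, which gives (i) and the first half of (ii). For t ∈ T the
-- closed neighbourhood of t also has m = |C| vertices and is mapped onto C,
-- so c is injective on it: the second half of (ii). For (iii), a neighbour
-- u ∈ T of some w ∈ δT with c w = c v is, for v ∈ T₁, also adjacent to v,
-- so v = w by (ii), contradicting w ∉ T.
module Submission where

open import Defs
open import Data.Nat using (ℕ; suc; _≤_; _<_; _≤ᵇ_; pred; z≤n; s≤s; >-nonZero)
import Data.Nat.Properties as ℕ
open import Data.Bool using (Bool; true; false)
open import Data.Bool.Properties using (T-≡)
open import Data.Fin using (Fin)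
open import Data.Fin.Properties using () renaming (_≟_ to _≟ᶠ_)
open import Data.List using (List; []; _∷_; length; map; filterᵇ; deduplicate; allFin)
open import Data.List.Properties using (length-map; length-removeAt′)
open import Data.List.Relation.Unary.Any using (here; there; index; _─_)
import Data.List.Relation.Unary.All as All
open import Data.List.Relation.Unary.AllPairs using ([]; _∷_)
open import Data.List.Relation.Unary.Unique.Propositional using (Unique)
open import Data.List.Relation.Unary.Unique.DecPropositional.Properties using (deduplicate-!)
open import Data.List.Relation.Binary.Subset.Propositional using (_⊆_)
open import Data.List.Membership.Propositional using (_∈_)
open import Data.List.Membership.Propositional.Properties
  using (∈-map⁺; ∈-map⁻; ∈-allFin; ∈-filter⁺; ∈-deduplicate⁺; ∈-deduplicate⁻; ∈-length)
open import Data.Product using (∃; _×_; _,_; proj₁; proj₂)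
open import Function using (_∘_)
open import Function.Bundles using (_⇔_; mk⇔; Equivalence)
open import Relation.Nullary using (¬_; yes; no; contradiction)
open import Relation.Nullary.Decidable using (T?)
open import Relation.Binary.Definitions using (DecidableEquality)
open import Relation.Binary.PropositionalEquality
  using (_≡_; _≢_; refl; sym; trans; cong; subst; ≢-sym)

module _ {A : Set} where

  ∈-─⁺ : ∀ {x y : A} {ys : List A} (x∈ys : x ∈ ys) → y ∈ ys → y ≢ x → y ∈ (ys ─ x∈ys)
  ∈-─⁺ (here refl) (here refl) y≢x = contradiction refl y≢x
  ∈-─⁺ (here refl) (there y∈ys) _   = y∈ys
  ∈-─⁺ (there _)   (here refl) _    = here refl
  ∈-─⁺ (there x∈ys) (there y∈ys) y≢x = there (∈-─⁺ x∈ys y∈ys y≢x)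

  unique-⊆⇒length≤ : ∀ {xs ys : List A} → Unique xs → xs ⊆ ys → length xs ≤ length ys
  unique-⊆⇒length≤ [] _ = z≤n
  unique-⊆⇒length≤ {x ∷ xs} {ys} (x∉xs ∷ xs!) xs⊆ys = begin
    suc (length xs)          ≤⟨ s≤s (unique-⊆⇒length≤ xs! xs⊆ys─x) ⟩
    suc (length (ys ─ x∈ys)) ≡⟨ length-removeAt′ ys (index x∈ys) ⟨
    length ys                ∎
    where
    open ℕ.≤-Reasoning
    x∈ys = xs⊆ys (here refl)
    xs⊆ys─x : xs ⊆ (ys ─ x∈ys)
    xs⊆ys─x y∈xs = ∈-─⁺ x∈ys (xs⊆ys (there y∈xs)) (≢-sym (All.lookup x∉xs y∈xs))

-- Pigeonhole: if a ≢ b but f a ≡ f b, the shorter list ys ─ b still covers xs.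
module _ {A B : Set} (_≟_ : DecidableEquality A) (f : A → B) where

  onto-unique⇒injective : ∀ {xs : List B} {ys : List A} → Unique xs →
    xs ⊆ map f ys → length ys ≤ length xs →
    ∀ {a b} → a ∈ ys → b ∈ ys → f a ≡ f b → a ≡ b
  onto-unique⇒injective {xs} {ys} xs! xs⊆fys |ys|≤|xs| {a} {b} a∈ys b∈ys fa≡fb
    with a ≟ b
  ... | yes a≡b = a≡b
  ... | no a≢b = contradiction (ℕ.≤-trans |ys|≤|xs| |xs|≤|ys─b|) |ys|≰|ys─b|
    where
    ys─b = ys ─ b∈ys
    f∈map─b : ∀ {y} → y ∈ ys → f y ∈ map f ys─b
    f∈map─b {y} y∈ys with y ≟ b
    ... | yes refl = subst (_∈ map f ys─b) fa≡fb (∈-map⁺ f (∈-─⁺ b∈ys a∈ys a≢b))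
    ... | no y≢b   = ∈-map⁺ f (∈-─⁺ b∈ys y∈ys y≢b)
    xs⊆fys─b : xs ⊆ map f ys─b
    xs⊆fys─b k∈xs with ∈-map⁻ f (xs⊆fys k∈xs)
    ... | y , y∈ys , refl = f∈map─b y∈ys
    |xs|≤|ys─b| : length xs ≤ length ys─b
    |xs|≤|ys─b| = subst (length xs ≤_) (length-map f ys─b) (unique-⊆⇒length≤ xs! xs⊆fys─b)
    |ys|≰|ys─b| : ¬ (length ys ≤ length ys─b)
    |ys|≰|ys─b| = ℕ.<⇒≱ (ℕ.≤-reflexive (sym (length-removeAt′ ys (index b∈ys))))

countᵇ≡length-filterᵇ : ∀ {A : Set} (p : A → Bool) xs → countᵇ p xs ≡ length (filterᵇ p xs)
countᵇ≡length-filterᵇ p [] = refl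
countᵇ≡length-filterᵇ p (x ∷ xs) with p x
... | true  = cong suc (countᵇ≡length-filterᵇ p xs)
... | false = countᵇ≡length-filterᵇ p xs

module _ {n : ℕ} (G : Graph n) where
  open Graph G using (adj)

  neighbours : Fin n → List (Fin n)
  neighbours v = filterᵇ (adj v) (allFin n)

  ∈-neighbours⁺ : ∀ {v u} → Adj G v u → u ∈ neighbours v
  ∈-neighbours⁺ {v} {u} vu = ∈-filter⁺ (T? ∘ adj v) (∈-allFin u) (Equivalence.from T-≡ vu)

  degree≡length-neighbours : ∀ v → degree G v ≡ length (neighbours v)
  degree≡length-neighbours v = countᵇ≡length-filterᵇ (adj v) (allFin n)

  denseVertices : List (Fin n)
  denseVertices = filterᵇ (λ v → pred (m G) ≤ᵇ degree G v) (allFin n)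

  ∈-denseVertices⁺ : ∀ {v} → Dense G v → v ∈ denseVertices
  ∈-denseVertices⁺ {v} dense =
    ∈-filter⁺ (λ u → T? (pred (m G) ≤ᵇ degree G u)) (∈-allFin v) (ℕ.≤⇒≤ᵇ dense)

  numDense≡length-denseVertices : numDense G ≡ length denseVertices
  numDense≡length-denseVertices = countᵇ≡length-filterᵇ _ (allFin n)

  colours : (Fin n → ℕ) → List ℕ
  colours c = deduplicate ℕ._≟_ (map c (allFin n))

  module _ {c : Fin n → ℕ} where

    colours-unique : Unique (colours c)
    colours-unique = deduplicate-! ℕ._≟_ (map c (allFin n))

    ∈-colours : ∀ v → c v ∈ colours c
    ∈-colours v = ∈-deduplicate⁺ ℕ._≟_ (∈-map⁺ c (∈-allFin v))

    ∈-colours⁻ : ∀ {k} → k ∈ colours c → ∃ λ v → k ≡ c v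
    ∈-colours⁻ k∈ with ∈-map⁻ c (∈-deduplicate⁻ ℕ._≟_ (map c (allFin n)) k∈)
    ... | v , _ , k≡cv = v , k≡cv

    bChromatic⇒colours⊆closedNeighbourhood : ∀ {v} → BChromatic G c v →
      colours c ⊆ map c (v ∷ neighbours v)
    bChromatic⇒colours⊆closedNeighbourhood {v} bv k∈ with ∈-colours⁻ k∈
    ... | w , refl with c w ℕ.≟ c v
    ... | yes cw≡cv = here cw≡cv
    ... | no cw≢cv with bv w cw≢cv
    ... | u , vu , cu≡cw =
      there (subst (_∈ map c (neighbours v)) cu≡cw (∈-map⁺ c (∈-neighbours⁺ vu)))

    numColours≤suc-degree : ∀ {v} → BChromatic G c v → numColours G c ≤ suc (degree G v)
    numColours≤suc-degree {v} bv = begin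
      length (colours c)                  ≤⟨ unique-⊆⇒length≤ colours-unique
                                               (bChromatic⇒colours⊆closedNeighbourhood bv) ⟩
      length (map c (v ∷ neighbours v))   ≡⟨ length-map c (v ∷ neighbours v) ⟩
      suc (length (neighbours v))         ≡⟨ cong suc (degree≡length-neighbours v) ⟨
      suc (degree G v)                    ∎
      where open ℕ.≤-Reasoning

module _ {n : ℕ} {G : Graph n} (tight : Tight G) {c : Fin n → ℕ} (tb : TightBColouring G c) where

  private
    numColours≡m : numColours G c ≡ m G
    numColours≡m = proj₂ tb

    proper : ∀ u v → Adj G u v → c u ≢ c v
    proper = proj₂ (proj₁ (proj₁ tb))

    bChromaticRepresentative : ∀ v → ∃ λ u → c u ≡ c v × BChromatic G c u
    bChromaticRepresentative = proj₂ (proj₁ tb)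

  bChromatic⇒dense : ∀ {v} → BChromatic G c v → Dense G v
  bChromatic⇒dense bv = ℕ.pred-mono-≤ (subst (_≤ _) numColours≡m (numColours≤suc-degree G bv))

  colours⊆map-denseVertices : colours G c ⊆ map c (denseVertices G)
  colours⊆map-denseVertices k∈ with ∈-colours⁻ G k∈
  ... | w , refl with bChromaticRepresentative w
  ... | u , cu≡cw , bu =
    subst (_∈ map c (denseVertices G)) cu≡cw (∈-map⁺ c (∈-denseVertices⁺ G (bChromatic⇒dense bu)))

  dense-colour-injective : ∀ {t t′} → Dense G t → Dense G t′ → c t ≡ c t′ → t ≡ t′
  dense-colour-injective dt dt′ =
    onto-unique⇒injective _≟ᶠ_ c (colours-unique G) colours⊆map-denseVertices |D|≤|C|
      (∈-denseVertices⁺ G dt) (∈-denseVertices⁺ G dt′)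
    where
    |D|≤|C| : length (denseVertices G) ≤ numColours G c
    |D|≤|C| = ℕ.≤-reflexive (trans (sym (numDense≡length-denseVertices G))
                                   (trans (proj₁ tight) (sym numColours≡m)))

  dense⇒bChromatic : ∀ {t} → Dense G t → BChromatic G c t
  dense⇒bChromatic {t} dt with bChromaticRepresentative t
  ... | u , cu≡ct , bu with dense-colour-injective (bChromatic⇒dense bu) dt cu≡ct
  ... | refl = bu

  neighbour-colour-injective : ∀ {t u u′} → Dense G t → Adj G t u → Adj G t u′ →
    c u ≡ c u′ → u ≡ u′
  neighbour-colour-injective {t} dt tu tu′ =
    onto-unique⇒injective _≟ᶠ_ c (colours-unique G)
      (bChromatic⇒colours⊆closedNeighbourhood G (dense⇒bChromatic dt)) |N[t]|≤|C|
      (there (∈-neighbours⁺ G tu)) (there (∈-neighbours⁺ G tu′))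
    where
    instance
      m-nonZero = >-nonZero (subst (0 <_) numColours≡m (∈-length (∈-colours G t)))
    open ℕ.≤-Reasoning
    |N[t]|≤|C| : length (t ∷ neighbours G t) ≤ numColours G c
    |N[t]|≤|C| = begin
      suc (length (neighbours G t)) ≡⟨ cong suc (degree≡length-neighbours G t) ⟨
      suc (degree G t)              ≡⟨ cong suc (proj₂ tight t dt) ⟩
      suc (pred (m G))              ≡⟨ ℕ.suc-pred (m G) ⟩
      m G                           ≡⟨ numColours≡m ⟨
      numColours G c                ∎

  dense⇔bChromatic : ∀ v → Dense G v ⇔ BChromatic G c v
  dense⇔bChromatic v = mk⇔ dense⇒bChromatic bChromatic⇒dense

  ∃!-dense-of-colour : ∀ v → ∃ λ t → Dense G t × c t ≡ c v
    × (∀ t′ → Dense G t′ → c t′ ≡ c v → t′ ≡ t)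
  ∃!-dense-of-colour v with bChromaticRepresentative v
  ... | t , ct≡cv , bt = t , dt , ct≡cv ,
    λ t′ dt′ ct′≡cv → dense-colour-injective dt′ dt (trans ct′≡cv (sym ct≡cv))
    where dt = bChromatic⇒dense bt

  ∃!-neighbour-of-colour : ∀ t → Dense G t → ∀ w → c w ≢ c t →
    ∃ λ u → Adj G t u × c u ≡ c w × (∀ u′ → Adj G t u′ → c u′ ≡ c w → u′ ≡ u)
  ∃!-neighbour-of-colour t dt w cw≢ct with dense⇒bChromatic dt w cw≢ct
  ... | u , tu , cu≡cw = u , tu , cu≡cw ,
    λ u′ tu′ cu′≡cw → neighbour-colour-injective dt tu′ tu (trans cu′≡cw (sym cu≡cw))

  T₁-colourClass-avoids-δT : ∀ v → Dense G v →
    (∀ t → Dense G t → t ≢ v → Adj G v t) → ∀ w → c w ≡ c v → ¬ InBoundaryT G w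
  T₁-colourClass-avoids-δT v dv v-dominates w cw≡cv (w-sparse , u , du , uw) =
    w-sparse (subst (Dense G) v≡w dv)
    where
    u≢v : u ≢ v
    u≢v refl = proper u w uw (sym cw≡cv)
    uv : Adj G u v
    uv = trans (Graph.sym G u v) (v-dominates u du u≢v)
    v≡w : v ≡ w
    v≡w = neighbour-colour-injective du uv uw (sym cw≡cv)

proposition12 : ∀ {n : ℕ} (G : Graph n) → Tight G →
    ∀ (c : Fin n → ℕ) → TightBColouring G c →
      (∀ v → Dense G v ⇔ BChromatic G c v)
      × (∀ v → ∃ λ t → Dense G t × c t ≡ c v
               × (∀ t′ → Dense G t′ → c t′ ≡ c v → t′ ≡ t))
      × (∀ t → Dense G t → ∀ w → c w ≢ c t →
           ∃ λ u → Adj G t u × c u ≡ c w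
             × (∀ u′ → Adj G t u′ → c u′ ≡ c w → u′ ≡ u))
      × (∀ v → Dense G v → (∀ t → Dense G t → t ≢ v → Adj G v t) →
           ∀ w → c w ≡ c v → ¬ InBoundaryT G w)
proposition12 G tight c tb =
    dense⇔bChromatic tight tb
  , ∃!-dense-of-colour tight tb
  , ∃!-neighbour-of-colour tight tb
  , T₁-colourClass-avoids-δT tight tb
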